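{- Let $G$ be a finite group and $(C_1,C_2,C_3,C_4)$ a class vector of $G$. For $k=1,2,3$ define $F_{4,k}=\langle \varphi_{4,k}\rangle\le H_4$, where $\varphi_{4,1}=\beta_2\beta_4^{ -1}$, $\varphi_{4,2}=(\beta_2\beta_3\beta_4)^2$ and $\varphi_{4,3}=\varphi_{4,1}\varphi_{4,2}$. For $[\underline{\sigma}]\in\Sigma^i(C_1,C_2,C_3,C_4)$ put $F_{B_4}(F_{4,k},[\underline{\sigma}])=1$ if $[\underline{\sigma}]^{\varphi}=[\underline{\sigma}]$ for all $\varphi\in F_{4,k}$, and $F_{B_4}(F_{4,k},[\underline{\sigma}])=-1$ otherwise. Then for each $k\in\{1,2,3\}$ the function $[\underline{\sigma}]\mapsto F_{B_4}(F_{4,k},[\underline{\sigma}])$ is invariant under the action of $B_4$ on $\Sigma^i(C_1,C_2,C_3,C_4)$, i.e. $F_{B_4}(F_{4,k},[\underline{\sigma}]^{\beta})=F_{B_4}(F_{4,k},[\underline{\sigma}])$ for all $\beta\in B_4$ and all $[\underline{\sigma}]\in\Sigma^i(C_1,C_2,C_3,C_4)$.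
   Context: For a finite group $G$ with identity $\iota$, a generating $m$-system is a tuple $(\sigma_1,\dots,\sigma_m)\in G^m$ with $\langle\sigma_1,\dots,\sigma_m\rangle=G$ and $\sigma_1\cdots\sigma_m=\iota$. $Inn(G)$ acts by simultaneous conjugation; $[\underline{\sigma}]=[\sigma_1,\dots,\sigma_m]$ denotes the class, $\Sigma^i_m(G)$ the set of classes. A class vector $(C_1,\dots,C_m)$ is a tuple of non-trivial conjugacy classes, and $\Sigma^i(C_1,\dots,C_m)$ is the set of classes $[\underline{\sigma}]$ of generating $m$-systems with $\sigma_i\in C_i$. $\Sigma^i(C_1,\dots,C_m)^{sy}$ is the union over $\pi\in S_m$ of $\Sigma^i(C_{\pi(1)},\dots,C_{\pi(m)})$. The full Hurwitz braid group $H_m$ is generated by $\beta_2,\dots,\beta_m$ with relations $\beta_i\beta_j=\beta_j\beta_i$ ($|i-j|>1$), $\beta_i\beta_{i+1}\beta_i=\beta_{i+1}\beta_i\beta_{i+1}$, $\beta_2\cdots\beta_{m-1}\beta_m^2\beta_{m-1}\cdots\beta_2=\iota$; it acts on the right on $\Sigma^i_m(G)$ (so $[\underline\sigma]^{\alpha\beta}=([\underline\sigma]^\alpha)^\beta$) by $[\underline{\sigma}]^{\beta_i}=[\sigma_1,\dots,\sigma_{i-2},\sigma_{i-1}\sigma_i\sigma_{i-1}^{ -1},\sigma_{i-1},\sigma_{i+1},\dots,\sigma_m]$, preserving $\Sigma^i(C_1,\dots,C_m)^{sy}$. The pure Hurwitz braid group $B_m$ is the kernel of $\pi_m:H_m\to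 S_m$, $\beta_i\mapsto(i-1,i)$; it is generated by $\beta_{ij}=\beta_{i+1}^{ -1}\cdots\beta_{j-1}^{ -1}\beta_j^2\beta_{j-1}\cdots\beta_{i+1}$ ($1\le i<j\le m$) and preserves each $\Sigma^i(C_1,\dots,C_m)$. Explicitly, for $m=4$: $[\underline\sigma]^{\varphi_{4,1}}=[\sigma_2,\sigma_1,\sigma_1^{ -1}\sigma_4\sigma_1,\sigma_1^{ -1}\sigma_4^{ -1}\sigma_3\sigma_4\sigma_1]$, $[\underline\sigma]^{\varphi_{4,2}}=[\sigma_3,\sigma_4,\sigma_1,\sigma_2]$, $[\underline\sigma]^{\varphi_{4,3}}=[\sigma_4,\sigma_4^{ -1}\sigma_3\sigma_4,\sigma_1\sigma_2\sigma_1^{ -1},\sigma_1]$. -}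

module Defs where

open import Level using (Level; _⊔_)
open import Algebra.Bundles using (Group)
open import Data.Nat using (ℕ; zero; suc)
open import Data.Integer using (ℤ; +_; -[1+_])
open import Data.Fin using (Fin; zero; suc)
open import Data.List using (List; []; _∷_; _++_; reverse; map; foldl)
open import Data.List.Relation.Unary.Any using (Any)
open import Data.Product using (Σ; ∃; _×_; _,_)
open import Relation.Binary.PropositionalEquality using (_≡_)
open import Relation.Nullary using (¬_)

record Quad {a} (A : Set a) : Set a where
  constructor quad
  field
    q₁ q₂ q₃ q₄ : A

-- An element of H₄ is represented by a word;
-- the action on Σⁱ is defined letter by letter (it factors through H₄).

data Gen : Set where
  β₂ β₃ β₄ : Gen

data Letter : Set where
  pos : Gen → Letter
  neg : Gen → Letter

Word : Set
Word = List Letter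

invLetter : Letter → Letter
invLetter (pos g) = neg g
invLetter (neg g) = pos g

invWord : Word → Word
invWord w = reverse (map invLetter w)

_^ᴺ_ : Word → ℕ → Word
w ^ᴺ zero = []
w ^ᴺ suc n = w ++ (w ^ᴺ n)

_^ᶻ_ : Word → ℤ → Word
w ^ᶻ (+ n) = w ^ᴺ n
w ^ᶻ -[1+ n ] = invWord w ^ᴺ suc n

-- φ_{4,1} = β₂ β₄⁻¹, φ_{4,2} = (β₂β₃β₄)², φ_{4,3} = φ_{4,1} φ_{4,2}
-- (indexed by Fin 3: zero ↦ k=1, suc zero ↦ k=2, suc (suc zero) ↦ k=3)
φ : Fin 3 → Word
φ zero = pos β₂ ∷ neg β₄ ∷ []
φ (suc zero) = w ++ w
  where w = pos β₂ ∷ pos β₃ ∷ pos β₄ ∷ []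
φ (suc (suc zero)) = φ zero ++ φ (suc zero)

-- π₄ : H₄ → S₄, β_i ↦ (i-1, i); the pure braid group B₄ = ker π₄.
-- A permutation is recorded by its effect on the positions of (0,1,2,3).

swapPos : ∀ {a} {A : Set a} → Gen → Quad A → Quad A
swapPos β₂ (quad a b c d) = quad b a c d
swapPos β₃ (quad a b c d) = quad a c b d
swapPos β₄ (quad a b c d) = quad a b d c

letterGen : Letter → Gen
letterGen (pos g) = g
letterGen (neg g) = g

perm : Word → Quad ℕ
perm w = foldl (λ q l → swapPos (letterGen l) q) (quad 0 1 2 3) w

Pure : Word → Set
Pure w = perm w ≡ quad 0 1 2 3

module OverGroup {c ℓ} (G : Group c ℓ) where
  open Group G

  Finite : Set (c ⊔ ℓ)
  Finite = ∃ λ n → Σ (Fin n → Carrier) λ f → ∀ g → ∃ λ i → f i ≈ g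

  data ⟨_⟩∋_ (S : List Carrier) : Carrier → Set (c ⊔ ℓ) where
    base : ∀ {x} → Any (_≈ x) S → ⟨ S ⟩∋ x
    one  : ⟨ S ⟩∋ ε
    mul  : ∀ {x y} → ⟨ S ⟩∋ x → ⟨ S ⟩∋ y → ⟨ S ⟩∋ (x ∙ y)
    inv  : ∀ {x} → ⟨ S ⟩∋ x → ⟨ S ⟩∋ (x ⁻¹)
    resp : ∀ {x y} → x ≈ y → ⟨ S ⟩∋ x → ⟨ S ⟩∋ y

  InClassOf : Carrier → Carrier → Set (c ⊔ ℓ)
  InClassOf x y = ∃ λ g → x ≈ g ∙ y ∙ g ⁻¹

  -- a class vector (C₁,…,C₄): non-trivial conjugacy classes, each given
  -- by a representative
  record ClassVector : Set (c ⊔ ℓ) where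
    field
      rep : Quad Carrier
      nontriv₁ : ¬ (Quad.q₁ rep ≈ ε)
      nontriv₂ : ¬ (Quad.q₂ rep ≈ ε)
      nontriv₃ : ¬ (Quad.q₃ rep ≈ ε)
      nontriv₄ : ¬ (Quad.q₄ rep ≈ ε)

  GenSystem : Quad Carrier → Set (c ⊔ ℓ)
  GenSystem (quad a b c' d) =
    (∀ g → ⟨ a ∷ b ∷ c' ∷ d ∷ [] ⟩∋ g) × (a ∙ b ∙ c' ∙ d ≈ ε)

  InΣ : ClassVector → Quad Carrier → Set (c ⊔ ℓ)
  InΣ C σ@(quad a b c' d) =
    GenSystem σ ×
    InClassOf a (Quad.q₁ (ClassVector.rep C)) ×
    InClassOf b (Quad.q₂ (ClassVector.rep C)) ×
    InClassOf c' (Quad.q₃ (ClassVector.rep C)) ×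
    InClassOf d (Quad.q₄ (ClassVector.rep C))

  -- equality of Inn(G)-classes: [σ] = [τ]
  _≋_ : Quad Carrier → Quad Carrier → Set (c ⊔ ℓ)
  quad a b c' d ≋ quad a' b' c'' d' = ∃ λ g →
    (a' ≈ g ∙ a ∙ g ⁻¹) × (b' ≈ g ∙ b ∙ g ⁻¹) ×
    (c'' ≈ g ∙ c' ∙ g ⁻¹) × (d' ≈ g ∙ d ∙ g ⁻¹)

  actLetter : Letter → Quad Carrier → Quad Carrier
  actLetter (pos β₂) (quad a b c' d) = quad (a ∙ b ∙ a ⁻¹) a c' d
  actLetter (pos β₃) (quad a b c' d) = quad a (b ∙ c' ∙ b ⁻¹) b d
  actLetter (pos β₄) (quad a b c' d) = quad a b (c' ∙ d ∙ c' ⁻¹) c'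
  actLetter (neg β₂) (quad a b c' d) = quad b (b ⁻¹ ∙ a ∙ b) c' d
  actLetter (neg β₃) (quad a b c' d) = quad a c' (c' ⁻¹ ∙ b ∙ c') d
  actLetter (neg β₄) (quad a b c' d) = quad a b d (d ⁻¹ ∙ c' ∙ d)

  act : Quad Carrier → Word → Quad Carrier
  act σ w = foldl (λ q l → actLetter l q) σ w

  -- F_{B₄}(F_{4,k},[σ]) = 1  iff  [σ]^ψ = [σ] for all ψ ∈ F_{4,k} = ⟨φ_{4,k}⟩
  FixedBy : Fin 3 → Quad Carrier → Set (c ⊔ ℓ)
  FixedBy k σ = ∀ (n : ℤ) → act σ (φ k ^ᶻ n) ≋ σ

open OverGroup public

-- The generators of H₄ normalise the cyclic groups F_{4,k} up to relabelling
-- k: on tuples with product ι one has [σ]^(β φ_{4,k}) = [σ]^(φ_{4,k′} β),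
-- where k′ comes from letting the transposition π₄(β) act on the pairing of
-- strands whose two transpositions form π₄(φ_{4,k}).  Hence [σ]^β is fixed by
-- F_{4,k} iff [σ] is fixed by F_{4,k′}, and along a braid word the index k
-- moves by the permutation of pairings induced by π₄; for a pure braid this
-- permutation is trivial.  Each commutation identity is an identity in the
-- free group on σ₁, σ₂, σ₃ (with σ₄ = (σ₁σ₂σ₃)⁻¹) and is checked by
-- computing reduced words.
module Submission where

open import Algebra.Bundles using (Group)
open import Data.Bool using (Bool; true; false; not; if_then_else_)
import Data.Bool.Properties as Bool
open import Data.Fin using (Fin; zero; suc)
import Data.Fin.Properties as Fin
open import Data.Integer using (+_; -[1+_])
open import Data.List using (List; []; _∷_; _++_; foldl; foldr; map)
open import Data.List.Properties using (foldl-++; ++-identityʳ; unfold-reverse)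
open import Data.Nat using (ℕ; zero; suc)
open import Data.Product using (∃; _×_; _,_)
open import Data.Product.Properties using (≡-dec)
open import Data.Vec using ([]; _∷_; lookup)
open import Function using (_∘_)
open import Function.Bundles using (_⇔_; mk⇔)
import Function.Properties.Equivalence as ⇔
open import Function.Construct.Identity using (⇔-id)
open import Function.Construct.Composition using (_⇔-∘_)
open import Level using (_⊔_)
open import Relation.Binary.Bundles using (Setoid)
import Relation.Binary.Reasoning.Setoid
open import Relation.Binary.PropositionalEquality
  using (_≡_; refl; sym; trans; cong; subst; module ≡-Reasoning)
open import Relation.Nullary using (yes; no)

open import Defs hiding (_≋_; act; actLetter; FixedBy)

-- Normal forms in free groups

infixl 7 _·_
infix  8 _⁻

data Expr (n : ℕ) : Set where
  var : Fin n → Expr n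
  ι   : Expr n
  _·_ : Expr n → Expr n → Expr n
  _⁻  : Expr n → Expr n

pattern x₀ = var zero
pattern x₁ = var (suc zero)
pattern x₂ = var (suc (suc zero))
pattern x₃ = var (suc (suc (suc zero)))

-- (true , i) is the i-th generator, (false , i) its inverse.
Literal : ℕ → Set
Literal n = Bool × Fin n

module _ {n : ℕ} where

  invert : Literal n → Literal n
  invert (b , i) = not b , i

  infixr 5 _◁_ _⊙_

  _◁_ : Literal n → List (Literal n) → List (Literal n)
  l ◁ [] = l ∷ []
  l ◁ (l′ ∷ ls) with ≡-dec Bool._≟_ Fin._≟_ l′ (invert l)
  ... | yes _ = ls
  ... | no  _ = l ∷ l′ ∷ ls

  _⊙_ : List (Literal n) → List (Literal n) → List (Literal n)
  ls ⊙ ms = foldr _◁_ ms ls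

  inverseNF : List (Literal n) → List (Literal n)
  inverseNF []       = []
  inverseNF (l ∷ ls) = inverseNF ls ⊙ invert l ∷ []

  nf : Expr n → List (Literal n)
  nf (var i) = (true , i) ∷ []
  nf ι       = []
  nf (x · y) = nf x ⊙ nf y
  nf (x ⁻)   = inverseNF (nf x)

module GroupSolver {c ℓ} (G : Group c ℓ) where
  open Group G renaming (refl to ≈-refl; sym to ≈-sym; trans to ≈-trans)
  open import Algebra.Properties.Group G using (⁻¹-involutive; ⁻¹-anti-homo-∙; ε⁻¹≈ε)
  open import Relation.Binary.Reasoning.Setoid setoid

  infix 9 ⟦_⟧_

  ⟦_⟧_ : ∀ {n} → Expr n → (Fin n → Carrier) → Carrier
  ⟦ var i ⟧ ρ = ρ i
  ⟦ ι ⟧     ρ = ε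
  ⟦ x · y ⟧ ρ = ⟦ x ⟧ ρ ∙ ⟦ y ⟧ ρ
  ⟦ x ⁻ ⟧   ρ = ⟦ x ⟧ ρ ⁻¹

  module _ {n : ℕ} (ρ : Fin n → Carrier) where

    ⟦_⟧ˡ : Literal n → Carrier
    ⟦ true  , i ⟧ˡ = ρ i
    ⟦ false , i ⟧ˡ = ρ i ⁻¹

    ⟦_⟧ʷ : List (Literal n) → Carrier
    ⟦ [] ⟧ʷ     = ε
    ⟦ l ∷ ls ⟧ʷ = ⟦ l ⟧ˡ ∙ ⟦ ls ⟧ʷ

    ⟦invert⟧ : ∀ l → ⟦ invert l ⟧ˡ ≈ ⟦ l ⟧ˡ ⁻¹
    ⟦invert⟧ (true  , i) = ≈-refl
    ⟦invert⟧ (false , i) = ≈-sym (⁻¹-involutive _)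

    ⟦⟧ˡ-inverseʳ : ∀ l → ⟦ l ⟧ˡ ∙ ⟦ invert l ⟧ˡ ≈ ε
    ⟦⟧ˡ-inverseʳ (true  , i) = inverseʳ (ρ i)
    ⟦⟧ˡ-inverseʳ (false , i) = inverseˡ (ρ i)

    ◁-sound : ∀ l ls → ⟦ l ◁ ls ⟧ʷ ≈ ⟦ l ⟧ˡ ∙ ⟦ ls ⟧ʷ
    ◁-sound l [] = ≈-refl
    ◁-sound l (l′ ∷ ls) with ≡-dec Bool._≟_ Fin._≟_ l′ (invert l)
    ... | no _ = ≈-refl
    ... | yes refl = begin
      ⟦ ls ⟧ʷ                            ≈⟨ identityˡ _ ⟨
      ε ∙ ⟦ ls ⟧ʷ                        ≈⟨ ∙-congʳ (⟦⟧ˡ-inverseʳ l) ⟨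
      ⟦ l ⟧ˡ ∙ ⟦ invert l ⟧ˡ ∙ ⟦ ls ⟧ʷ   ≈⟨ assoc _ _ _ ⟩
      ⟦ l ⟧ˡ ∙ (⟦ invert l ⟧ˡ ∙ ⟦ ls ⟧ʷ) ∎

    ⊙-sound : ∀ ls ms → ⟦ ls ⊙ ms ⟧ʷ ≈ ⟦ ls ⟧ʷ ∙ ⟦ ms ⟧ʷ
    ⊙-sound [] ms = ≈-sym (identityˡ _)
    ⊙-sound (l ∷ ls) ms = begin
      ⟦ l ◁ (ls ⊙ ms) ⟧ʷ           ≈⟨ ◁-sound l (ls ⊙ ms) ⟩
      ⟦ l ⟧ˡ ∙ ⟦ ls ⊙ ms ⟧ʷ        ≈⟨ ∙-congˡ (⊙-sound ls ms) ⟩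
      ⟦ l ⟧ˡ ∙ (⟦ ls ⟧ʷ ∙ ⟦ ms ⟧ʷ) ≈⟨ assoc _ _ _ ⟨
      ⟦ l ⟧ˡ ∙ ⟦ ls ⟧ʷ ∙ ⟦ ms ⟧ʷ   ∎

    inverseNF-sound : ∀ ls → ⟦ inverseNF ls ⟧ʷ ≈ ⟦ ls ⟧ʷ ⁻¹
    inverseNF-sound [] = ≈-sym ε⁻¹≈ε
    inverseNF-sound (l ∷ ls) = begin
      ⟦ inverseNF ls ⊙ invert l ∷ [] ⟧ʷ     ≈⟨ ⊙-sound (inverseNF ls) _ ⟩
      ⟦ inverseNF ls ⟧ʷ ∙ (⟦ invert l ⟧ˡ ∙ ε) ≈⟨ ∙-cong (inverseNF-sound ls) (≈-trans (identityʳ _) (⟦invert⟧ l)) ⟩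
      ⟦ ls ⟧ʷ ⁻¹ ∙ ⟦ l ⟧ˡ ⁻¹                 ≈⟨ ⁻¹-anti-homo-∙ _ _ ⟨
      (⟦ l ⟧ˡ ∙ ⟦ ls ⟧ʷ) ⁻¹                 ∎

    nf-sound : ∀ x → ⟦ x ⟧ ρ ≈ ⟦ nf x ⟧ʷ
    nf-sound (var i) = ≈-sym (identityʳ _)
    nf-sound ι       = ≈-refl
    nf-sound (x · y) = ≈-trans (∙-cong (nf-sound x) (nf-sound y)) (≈-sym (⊙-sound (nf x) (nf y)))
    nf-sound (x ⁻)   = ≈-trans (⁻¹-cong (nf-sound x)) (≈-sym (inverseNF-sound (nf x)))

    solve : ∀ x y → nf x ≡ nf y → ⟦ x ⟧ ρ ≈ ⟦ y ⟧ ρ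
    solve x y eq = begin
      ⟦ x ⟧ ρ      ≈⟨ nf-sound x ⟩
      ⟦ nf x ⟧ʷ    ≡⟨ cong ⟦_⟧ʷ eq ⟩
      ⟦ nf y ⟧ʷ    ≈⟨ nf-sound y ⟨
      ⟦ y ⟧ ρ      ∎

-- Pure braids fix the three pairings of the four positions

module _ {a} {A : Set a} where

  mapQ : ∀ {b} {B : Set b} → (A → B) → Quad A → Quad B
  mapQ f (quad x y z u) = quad (f x) (f y) (f z) (f u)

  swapPos-mapQ : ∀ {b} {B : Set b} (f : A → B) g q → swapPos g (mapQ f q) ≡ mapQ f (swapPos g q)
  swapPos-mapQ f β₂ q = refl
  swapPos-mapQ f β₃ q = refl
  swapPos-mapQ f β₄ q = refl

  swapPos-involutive : ∀ g (q : Quad A) → swapPos g (swapPos g q) ≡ q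
  swapPos-involutive β₂ q = refl
  swapPos-involutive β₃ q = refl
  swapPos-involutive β₄ q = refl

  swapsˡ : Word → Quad A → Quad A
  swapsˡ w q = foldl (λ q l → swapPos (letterGen l) q) q w

  swapsʳ : Word → Quad A → Quad A
  swapsʳ w q = foldr (λ l q → swapPos (letterGen l) q) q w

  swapsˡ-swapsʳ : ∀ w q → swapsˡ w (swapsʳ w q) ≡ q
  swapsˡ-swapsʳ []      q = refl
  swapsˡ-swapsʳ (l ∷ w) q =
    trans (cong (swapsˡ w) (swapPos-involutive (letterGen l) (swapsʳ w q))) (swapsˡ-swapsʳ w q)

swapsˡ-mapQ : ∀ {a b} {A : Set a} {B : Set b} (f : A → B) w q →
              swapsˡ w (mapQ f q) ≡ mapQ f (swapsˡ w q)
swapsˡ-mapQ f []      q = refl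
swapsˡ-mapQ f (l ∷ w) q =
  trans (cong (swapsˡ w) (swapPos-mapQ f (letterGen l) q)) (swapsˡ-mapQ f w (swapPos (letterGen l) q))

module _ {a} {A : Set a} where

  private
    entry : Quad A → ℕ → A
    entry q 0 = Quad.q₁ q
    entry q 1 = Quad.q₂ q
    entry q 2 = Quad.q₃ q
    entry q _ = Quad.q₄ q

  -- q is the relabelling of quad 0 1 2 3 by its own entries.
  Pure⇒swapsˡ≡id : ∀ w → Pure w → (q : Quad A) → swapsˡ w q ≡ q
  Pure⇒swapsˡ≡id w pure q = begin
    swapsˡ w (mapQ (entry q) (quad 0 1 2 3)) ≡⟨ swapsˡ-mapQ (entry q) w (quad 0 1 2 3) ⟩
    mapQ (entry q) (perm w)                 ≡⟨ cong (mapQ (entry q)) pure ⟩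
    q                                       ∎
    where open ≡-Reasoning

  Pure⇒swapsʳ≡id : ∀ w → Pure w → (q : Quad A) → swapsʳ w q ≡ q
  Pure⇒swapsʳ≡id w pure q =
    trans (sym (Pure⇒swapsˡ≡id w pure (swapsʳ w q))) (swapsˡ-swapsʳ w q)

-- π₄ (φ k) is the product of the two transpositions of the pairing
-- {12|34}, {13|24}, {14|23} of the strands, for k = zero, suc zero,
-- suc (suc zero).  A pairing is recorded as a 2-colouring of the
-- positions up to exchanging the colours; normalise picks the colouring
-- with position 1 true.
pairing : Fin 3 → Quad Bool
pairing zero             = quad true true false false
pairing (suc zero)       = quad true false true false
pairing (suc (suc zero)) = quad true false false true

normalise : Quad Bool → Quad Bool
normalise q = if Quad.q₁ q then q else mapQ not q

pairingIndex : Quad Bool → Fin 3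
pairingIndex (quad _ true  _     _) = zero
pairingIndex (quad _ false true  _) = suc zero
pairingIndex (quad _ false false _) = suc (suc zero)

swapPairing : Gen → Fin 3 → Fin 3
swapPairing g k = pairingIndex (normalise (swapPos g (pairing k)))

swapPairing-involutive : ∀ g k → swapPairing g (swapPairing g k) ≡ k
swapPairing-involutive β₂ zero             = refl
swapPairing-involutive β₂ (suc zero)       = refl
swapPairing-involutive β₂ (suc (suc zero)) = refl
swapPairing-involutive β₃ zero             = refl
swapPairing-involutive β₃ (suc zero)       = refl
swapPairing-involutive β₃ (suc (suc zero)) = refl
swapPairing-involutive β₄ zero             = refl
swapPairing-involutive β₄ (suc zero)       = refl
swapPairing-involutive β₄ (suc (suc zero)) = refl

swapPairings : Word → Fin 3 → Fin 3
swapPairings []      k = k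
swapPairings (l ∷ w) k = swapPairing (letterGen l) (swapPairings w k)

pairingIndex-pairing : ∀ k → pairingIndex (pairing k) ≡ k
pairingIndex-pairing zero             = refl
pairingIndex-pairing (suc zero)       = refl
pairingIndex-pairing (suc (suc zero)) = refl

normalise-pairing : ∀ k → normalise (pairing k) ≡ pairing k
normalise-pairing zero             = refl
normalise-pairing (suc zero)       = refl
normalise-pairing (suc (suc zero)) = refl

normalise-swapPos-pairing : ∀ g k → normalise (swapPos g (pairing k)) ≡ pairing (swapPairing g k)
normalise-swapPos-pairing β₂ zero             = refl
normalise-swapPos-pairing β₂ (suc zero)       = refl
normalise-swapPos-pairing β₂ (suc (suc zero)) = refl
normalise-swapPos-pairing β₃ zero             = refl
normalise-swapPos-pairing β₃ (suc zero)       = refl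
normalise-swapPos-pairing β₃ (suc (suc zero)) = refl
normalise-swapPos-pairing β₄ zero             = refl
normalise-swapPos-pairing β₄ (suc zero)       = refl
normalise-swapPos-pairing β₄ (suc (suc zero)) = refl

normalise-complement : ∀ q → normalise (mapQ not q) ≡ normalise q
normalise-complement (quad true  y z u)
  rewrite Bool.not-involutive y | Bool.not-involutive z | Bool.not-involutive u = refl
normalise-complement (quad false y z u) = refl

normalise-swapPos-normalise : ∀ g q → normalise (swapPos g (normalise q)) ≡ normalise (swapPos g q)
normalise-swapPos-normalise g (quad true  y z u) = refl
normalise-swapPos-normalise g (quad false y z u) = begin
  normalise (swapPos g (mapQ not q)) ≡⟨ cong normalise (swapPos-mapQ not g q) ⟩
  normalise (mapQ not (swapPos g q)) ≡⟨ normalise-complement (swapPos g q) ⟩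
  normalise (swapPos g q)            ∎
  where
  open ≡-Reasoning
  q = quad false y z u

normalise-swapsʳ-pairing : ∀ w k → normalise (swapsʳ w (pairing k)) ≡ pairing (swapPairings w k)
normalise-swapsʳ-pairing []      k = normalise-pairing k
normalise-swapsʳ-pairing (l ∷ w) k = begin
  normalise (swapPos g (swapsʳ w (pairing k)))
    ≡⟨ normalise-swapPos-normalise g _ ⟨
  normalise (swapPos g (normalise (swapsʳ w (pairing k))))
    ≡⟨ cong (normalise ∘ swapPos g) (normalise-swapsʳ-pairing w k) ⟩
  normalise (swapPos g (pairing (swapPairings w k)))
    ≡⟨ normalise-swapPos-pairing g _ ⟩
  pairing (swapPairing g (swapPairings w k))
    ∎
  where
  open ≡-Reasoning
  g = letterGen l

Pure⇒swapPairings≡id : ∀ w → Pure w → ∀ k → swapPairings w k ≡ k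
Pure⇒swapPairings≡id w pure k = begin
  swapPairings w k
    ≡⟨ pairingIndex-pairing _ ⟨
  pairingIndex (pairing (swapPairings w k))
    ≡⟨ cong pairingIndex (normalise-swapsʳ-pairing w k) ⟨
  pairingIndex (normalise (swapsʳ w (pairing k)))
    ≡⟨ cong (pairingIndex ∘ normalise) (Pure⇒swapsʳ≡id w pure (pairing k)) ⟩
  pairingIndex (normalise (pairing k))
    ≡⟨ cong pairingIndex (normalise-pairing k) ⟩
  pairingIndex (pairing k)
    ≡⟨ pairingIndex-pairing k ⟩
  k ∎
  where open ≡-Reasoning

-- The braid action on symbolic tuples

module _ {n : ℕ} where

  actLetterₑ : Letter → Quad (Expr n) → Quad (Expr n)
  actLetterₑ (pos β₂) (quad a b c d) = quad (a · b · a ⁻) a c d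
  actLetterₑ (pos β₃) (quad a b c d) = quad a (b · c · b ⁻) b d
  actLetterₑ (pos β₄) (quad a b c d) = quad a b (c · d · c ⁻) c
  actLetterₑ (neg β₂) (quad a b c d) = quad b (b ⁻ · a · b) c d
  actLetterₑ (neg β₃) (quad a b c d) = quad a c (c ⁻ · b · c) d
  actLetterₑ (neg β₄) (quad a b c d) = quad a b d (d ⁻ · c · d)

  actₑ : Quad (Expr n) → Word → Quad (Expr n)
  actₑ q w = foldl (λ q l → actLetterₑ l q) q w

  productₑ : Quad (Expr n) → Expr n
  productₑ (quad a b c d) = a · b · c · d

  _≋ₑ[_]_ : Quad (Expr n) → Expr n → Quad (Expr n) → Set
  quad a b c d ≋ₑ[ h ] quad a′ b′ c′ d′ =
    nf a′ ≡ nf (h · a · h ⁻) × nf b′ ≡ nf (h · b · h ⁻) ×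
    nf c′ ≡ nf (h · c · h ⁻) × nf d′ ≡ nf (h · d · h ⁻)

generic : Quad (Expr 4)
generic = quad x₀ x₁ x₂ x₃

genericProductOne : Quad (Expr 4)
genericProductOne = quad x₀ x₁ x₂ ((x₀ · x₁ · x₂) ⁻)

productₑ-actLetterₑ : ∀ l → nf (productₑ (actLetterₑ l generic)) ≡ nf (productₑ generic)
productₑ-actLetterₑ (pos β₂) = refl
productₑ-actLetterₑ (pos β₃) = refl
productₑ-actLetterₑ (pos β₄) = refl
productₑ-actLetterₑ (neg β₂) = refl
productₑ-actLetterₑ (neg β₃) = refl
productₑ-actLetterₑ (neg β₄) = refl

actₑ-invLetter : ∀ l → actₑ generic [] ≋ₑ[ ι ] actₑ generic (l ∷ invLetter l ∷ [])
actₑ-invLetter (pos β₂) = refl , refl , refl , refl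
actₑ-invLetter (pos β₃) = refl , refl , refl , refl
actₑ-invLetter (pos β₄) = refl , refl , refl , refl
actₑ-invLetter (neg β₂) = refl , refl , refl , refl
actₑ-invLetter (neg β₃) = refl , refl , refl , refl
actₑ-invLetter (neg β₄) = refl , refl , refl , refl

-- Read off from the normal forms of both sides of the identity below.
conjugator : Gen → Fin 3 → Expr 4
conjugator β₂ zero             = ι
conjugator β₂ (suc zero)       = ι
conjugator β₂ (suc (suc zero)) = x₁ ⁻ · x₀ ⁻
conjugator β₃ zero             = x₀ · x₁ · x₂ ⁻ · x₁ ⁻ · x₀ ⁻
conjugator β₃ (suc zero)       = x₀ · x₁ · x₂ ⁻ · x₁ ⁻ · x₀ ⁻
conjugator β₃ (suc (suc zero)) = x₀ · x₁ · x₁ · x₂ ⁻ · x₁ ⁻ · x₀ ⁻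
conjugator β₄ zero             = ι
conjugator β₄ (suc zero)       = x₀ · x₁
conjugator β₄ (suc (suc zero)) = ι

β-φₑ : ∀ g k → actₑ genericProductOne (pos g ∷ φ k)
                 ≋ₑ[ conjugator g k ] actₑ genericProductOne (φ (swapPairing g k) ++ pos g ∷ [])
β-φₑ β₂ zero             = refl , refl , refl , refl
β-φₑ β₂ (suc zero)       = refl , refl , refl , refl
β-φₑ β₂ (suc (suc zero)) = refl , refl , refl , refl
β-φₑ β₃ zero             = refl , refl , refl , refl
β-φₑ β₃ (suc zero)       = refl , refl , refl , refl
β-φₑ β₃ (suc (suc zero)) = refl , refl , refl , refl
β-φₑ β₄ zero             = refl , refl , refl , refl
β-φₑ β₄ (suc zero)       = refl , refl , refl , refl
β-φₑ β₄ (suc (suc zero)) = refl , refl , refl , refl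

-- The Hurwitz action on Inn(G)-classes of tuples

module HurwitzAction {c ℓ} (G : Group c ℓ) where
  open Group G renaming (refl to ≈-refl; sym to ≈-sym; trans to ≈-trans)
  open import Algebra.Properties.Group G using (inverseʳ-unique)
  open OverGroup G using (_≋_; act; actLetter; FixedBy)
  open GroupSolver G

  Tuple : Set c
  Tuple = Quad Carrier

  conj : Carrier → Carrier → Carrier
  conj g x = g ∙ x ∙ g ⁻¹

  conj-cong : ∀ g {x y} → x ≈ y → conj g x ≈ conj g y
  conj-cong g x≈y = ∙-congʳ (∙-congˡ x≈y)

  conj-ε : ∀ x → conj ε x ≈ x
  conj-ε x = solve (lookup (x ∷ [])) (ι · x₀ · ι ⁻) x₀ refl

  conj-∙ : ∀ h g x → conj h (conj g x) ≈ conj (h ∙ g) x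
  conj-∙ h g x = solve (lookup (h ∷ g ∷ x ∷ []))
    (x₀ · (x₁ · x₂ · x₁ ⁻) · x₀ ⁻) (x₀ · x₁ · x₂ · (x₀ · x₁) ⁻) refl

  conj-⁻¹ : ∀ g x → conj (g ⁻¹) (conj g x) ≈ x
  conj-⁻¹ g x = solve (lookup (g ∷ x ∷ [])) (x₀ ⁻ · (x₀ · x₁ · x₀ ⁻) · x₀ ⁻ ⁻) x₁ refl

  ⟦⟧-conj : ∀ {n} {ρ ρ′ : Fin n → Carrier} {g} → (∀ i → ρ′ i ≈ conj g (ρ i)) →
            ∀ x → ⟦ x ⟧ ρ′ ≈ conj g (⟦ x ⟧ ρ)
  ⟦⟧-conj ρ′≈ (var i) = ρ′≈ i
  ⟦⟧-conj {g = g} ρ′≈ ι = solve (lookup (g ∷ [])) ι (x₀ · ι · x₀ ⁻) refl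
  ⟦⟧-conj {ρ = ρ} {g = g} ρ′≈ (x · y) = ≈-trans (∙-cong (⟦⟧-conj ρ′≈ x) (⟦⟧-conj ρ′≈ y))
    (solve (lookup (g ∷ ⟦ x ⟧ ρ ∷ ⟦ y ⟧ ρ ∷ []))
      ((x₀ · x₁ · x₀ ⁻) · (x₀ · x₂ · x₀ ⁻)) (x₀ · (x₁ · x₂) · x₀ ⁻) refl)
  ⟦⟧-conj {ρ = ρ} {g = g} ρ′≈ (x ⁻) = ≈-trans (⁻¹-cong (⟦⟧-conj ρ′≈ x))
    (solve (lookup (g ∷ ⟦ x ⟧ ρ ∷ [])) ((x₀ · x₁ · x₀ ⁻) ⁻) (x₀ · x₁ ⁻ · x₀ ⁻) refl)

  -- mapQ (⟦_⟧ (entries σ)) generic is definitionally σ.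
  entries : Tuple → Fin 4 → Carrier
  entries (quad a b c′ d) = lookup (a ∷ b ∷ c′ ∷ d ∷ [])

  ≋-intro : ∀ {σ τ} g → (∀ i → entries τ i ≈ conj g (entries σ i)) → σ ≋ τ
  ≋-intro g τ≈ = g , τ≈ zero , τ≈ (suc zero) , τ≈ (suc (suc zero)) , τ≈ (suc (suc (suc zero)))

  ≋-elim : ∀ {σ τ} → σ ≋ τ → ∃ λ g → ∀ i → entries τ i ≈ conj g (entries σ i)
  ≋-elim (g , a , b , c′ , d) = g , λ where
    zero                   → a
    (suc zero)             → b
    (suc (suc zero))       → c′
    (suc (suc (suc zero))) → d

  ≋-refl : ∀ {σ} → σ ≋ σ
  ≋-refl = ≋-intro ε (λ i → ≈-sym (conj-ε _))

  ≋-sym : ∀ {σ τ} → σ ≋ τ → τ ≋ σ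
  ≋-sym σ≋τ with g , τ≈ ← ≋-elim σ≋τ =
    ≋-intro (g ⁻¹) (λ i → ≈-sym (≈-trans (conj-cong (g ⁻¹) (τ≈ i)) (conj-⁻¹ g _)))

  ≋-trans : ∀ {σ τ υ} → σ ≋ τ → τ ≋ υ → σ ≋ υ
  ≋-trans σ≋τ τ≋υ with g , τ≈ ← ≋-elim σ≋τ | h , υ≈ ← ≋-elim τ≋υ =
    ≋-intro (h ∙ g) (λ i → ≈-trans (υ≈ i) (≈-trans (conj-cong h (τ≈ i)) (conj-∙ h g _)))

  ≋-setoid : Setoid c (c ⊔ ℓ)
  ≋-setoid = record
    { Carrier       = Tuple
    ; _≈_           = _≋_
    ; isEquivalence = record { refl = ≋-refl ; sym = ≋-sym ; trans = ≋-trans }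
    }

  module ≋-Reasoning = Relation.Binary.Reasoning.Setoid ≋-setoid

  ⟦⟧-actLetter : ∀ {n} (ρ : Fin n → Carrier) l q →
                 mapQ (⟦_⟧ ρ) (actLetterₑ l q) ≡ actLetter l (mapQ (⟦_⟧ ρ) q)
  ⟦⟧-actLetter ρ (pos β₂) q = refl
  ⟦⟧-actLetter ρ (pos β₃) q = refl
  ⟦⟧-actLetter ρ (pos β₄) q = refl
  ⟦⟧-actLetter ρ (neg β₂) q = refl
  ⟦⟧-actLetter ρ (neg β₃) q = refl
  ⟦⟧-actLetter ρ (neg β₄) q = refl

  ⟦⟧-act : ∀ {n} (ρ : Fin n → Carrier) q w → mapQ (⟦_⟧ ρ) (actₑ q w) ≡ act (mapQ (⟦_⟧ ρ) q) w
  ⟦⟧-act ρ q []      = refl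
  ⟦⟧-act ρ q (l ∷ w) =
    trans (⟦⟧-act ρ (actLetterₑ l q) w) (cong (λ σ → act σ w) (⟦⟧-actLetter ρ l q))

  ≋ₑ-sound : ∀ {n} (ρ : Fin n → Carrier) h p q → p ≋ₑ[ h ] q → mapQ (⟦_⟧ ρ) p ≋ mapQ (⟦_⟧ ρ) q
  ≋ₑ-sound ρ h (quad a b c′ d) (quad a′ b′ c″ d′) (ea , eb , ec , ed) =
    ⟦ h ⟧ ρ , solve ρ a′ (h · a · h ⁻) ea , solve ρ b′ (h · b · h ⁻) eb ,
              solve ρ c″ (h · c′ · h ⁻) ec , solve ρ d′ (h · d · h ⁻) ed

  ⟦⟧-≋ : ∀ {n} {ρ ρ′ : Fin n → Carrier} g → (∀ i → ρ′ i ≈ conj g (ρ i)) →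
         ∀ q → mapQ (⟦_⟧ ρ) q ≋ mapQ (⟦_⟧ ρ′) q
  ⟦⟧-≋ g ρ′≈ (quad a b c′ d) = g , ⟦⟧-conj ρ′≈ a , ⟦⟧-conj ρ′≈ b , ⟦⟧-conj ρ′≈ c′ , ⟦⟧-conj ρ′≈ d

  actLetter-cong : ∀ l {σ τ} → σ ≋ τ → actLetter l σ ≋ actLetter l τ
  actLetter-cong l {σ} {τ} σ≋τ with g , τ≈ ← ≋-elim σ≋τ = begin
    actLetter l σ                                       ≡⟨ ⟦⟧-actLetter (entries σ) l generic ⟨
    mapQ (⟦_⟧ (entries σ)) (actLetterₑ l generic)   ≈⟨ ⟦⟧-≋ g τ≈ (actLetterₑ l generic) ⟩
    mapQ (⟦_⟧ (entries τ)) (actLetterₑ l generic)   ≡⟨ ⟦⟧-actLetter (entries τ) l generic ⟩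
    actLetter l τ                                       ∎
    where open ≋-Reasoning

  act-cong : ∀ w {σ τ} → σ ≋ τ → act σ w ≋ act τ w
  act-cong []      σ≋τ = σ≋τ
  act-cong (l ∷ w) σ≋τ = act-cong w (actLetter-cong l σ≋τ)

  act-++ : ∀ σ u v → act σ (u ++ v) ≡ act (act σ u) v
  act-++ σ u v = foldl-++ (λ q l → actLetter l q) σ u v

  actLetter-inverse : ∀ l σ → actLetter (invLetter l) (actLetter l σ) ≋ σ
  actLetter-inverse l σ = begin
    actLetter (invLetter l) (actLetter l σ)  ≡⟨ ⟦⟧-act (entries σ) generic w ⟨
    mapQ (⟦_⟧ (entries σ)) (actₑ generic w)
      ≈⟨ ≋ₑ-sound (entries σ) ι (actₑ generic []) (actₑ generic w) (actₑ-invLetter l) ⟨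
    σ                                        ∎
    where
    open ≋-Reasoning
    w = l ∷ invLetter l ∷ []

  act-invWord : ∀ w σ → act (act σ w) (invWord w) ≋ σ
  act-invWord []      σ = ≋-refl
  act-invWord (l ∷ w) σ = begin
    act (act σ (l ∷ w)) (invWord (l ∷ w))
      ≡⟨ cong (act (act σ (l ∷ w))) (unfold-reverse (invLetter l) (map invLetter w)) ⟩
    act (act σ (l ∷ w)) (invWord w ++ invLetter l ∷ [])
      ≡⟨ act-++ (act σ (l ∷ w)) (invWord w) _ ⟩
    actLetter (invLetter l) (act (act (actLetter l σ) w) (invWord w))
      ≈⟨ actLetter-cong (invLetter l) (act-invWord w (actLetter l σ)) ⟩
    actLetter (invLetter l) (actLetter l σ)
      ≈⟨ actLetter-inverse l σ ⟩
    σ ∎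
    where open ≋-Reasoning

  product : Tuple → Carrier
  product (quad a b c′ d) = a ∙ b ∙ c′ ∙ d

  product-actLetter : ∀ l σ → product (actLetter l σ) ≈ product σ
  product-actLetter l σ = begin
    product (actLetter l σ)
      ≡⟨ cong product (⟦⟧-actLetter (entries σ) l generic) ⟨
    ⟦ productₑ (actLetterₑ l generic) ⟧ entries σ
      ≈⟨ solve (entries σ) (productₑ (actLetterₑ l generic)) (productₑ generic) (productₑ-actLetterₑ l) ⟩
    product σ ∎
    where open Relation.Binary.Reasoning.Setoid setoid

  -- The last entry of a tuple with product ε is determined by the others.
  ≋-genericProductOne : ∀ σ → product σ ≈ ε → σ ≋ mapQ (⟦_⟧ (entries σ)) genericProductOne
  ≋-genericProductOne (quad a b c′ d) abcd≈ε =
    ≋-intro ε λ where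
      zero                   → ≈-sym (conj-ε a)
      (suc zero)             → ≈-sym (conj-ε b)
      (suc (suc zero))       → ≈-sym (conj-ε c′)
      (suc (suc (suc zero))) →
        ≈-trans (≈-sym (inverseʳ-unique (a ∙ b ∙ c′) d abcd≈ε)) (≈-sym (conj-ε d))

  β-φ⁺ : ∀ g k σ → product σ ≈ ε →
         act σ (pos g ∷ φ k) ≋ actLetter (pos g) (act σ (φ (swapPairing g k)))
  β-φ⁺ g k σ σ≈ε = begin
    act σ u                    ≈⟨ act-cong u σ≋τ ⟩
    act τ u                    ≡⟨ ⟦⟧-act ρ genericProductOne u ⟨
    mapQ (⟦_⟧ ρ) (actₑ genericProductOne u)
      ≈⟨ ≋ₑ-sound ρ (conjugator g k) (actₑ genericProductOne u) (actₑ genericProductOne v) (β-φₑ g k) ⟩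
    mapQ (⟦_⟧ ρ) (actₑ genericProductOne v) ≡⟨ ⟦⟧-act ρ genericProductOne v ⟩
    act τ v                    ≈⟨ act-cong v σ≋τ ⟨
    act σ v                    ≡⟨ act-++ σ (φ (swapPairing g k)) (pos g ∷ []) ⟩
    actLetter (pos g) (act σ (φ (swapPairing g k))) ∎
    where
    open ≋-Reasoning
    u = pos g ∷ φ k
    v = φ (swapPairing g k) ++ pos g ∷ []
    ρ = entries σ
    τ = mapQ (⟦_⟧ ρ) genericProductOne
    σ≋τ = ≋-genericProductOne σ σ≈ε

  -- For β⁻¹ apply the identity for β at σ^(β⁻¹) and cancel.
  β-φ : ∀ l k σ → product σ ≈ ε →
        act σ (l ∷ φ k) ≋ actLetter l (act σ (φ (swapPairing (letterGen l) k)))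
  β-φ (pos g) = β-φ⁺ g
  β-φ (neg g) k σ σ≈ε = begin
    act τ (φ k)                                       ≈⟨ actLetter-inverse (pos g) _ ⟨
    actLetter (neg g) (actLetter (pos g) (act τ (φ k)))
      ≡⟨ cong (λ j → actLetter (neg g) (actLetter (pos g) (act τ (φ j)))) (swapPairing-involutive g k) ⟨
    actLetter (neg g) (actLetter (pos g) (act τ (φ (swapPairing g k′))))
      ≈⟨ actLetter-cong (neg g) (β-φ⁺ g k′ τ (≈-trans (product-actLetter (neg g) σ) σ≈ε)) ⟨
    actLetter (neg g) (act (actLetter (pos g) τ) (φ k′))
      ≈⟨ actLetter-cong (neg g) (act-cong (φ k′) (actLetter-inverse (neg g) σ)) ⟩
    actLetter (neg g) (act σ (φ k′))                  ∎
    where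
    open ≋-Reasoning
    τ = actLetter (neg g) σ
    k′ = swapPairing g k

  Fixes : Word → Tuple → Set (c ⊔ ℓ)
  Fixes ψ σ = act σ ψ ≋ σ

  Fixes-^ᴺ : ∀ ψ {σ} → Fixes ψ σ → ∀ n → Fixes (ψ ^ᴺ n) σ
  Fixes-^ᴺ ψ     σ-fixed zero    = ≋-refl
  Fixes-^ᴺ ψ {σ} σ-fixed (suc n) = begin
    act σ (ψ ++ ψ ^ᴺ n)     ≡⟨ act-++ σ ψ (ψ ^ᴺ n) ⟩
    act (act σ ψ) (ψ ^ᴺ n)  ≈⟨ act-cong (ψ ^ᴺ n) σ-fixed ⟩
    act σ (ψ ^ᴺ n)          ≈⟨ Fixes-^ᴺ ψ σ-fixed n ⟩
    σ                       ∎
    where open ≋-Reasoning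

  Fixes-invWord : ∀ ψ {σ} → Fixes ψ σ → Fixes (invWord ψ) σ
  Fixes-invWord ψ σ-fixed = ≋-trans (act-cong (invWord ψ) (≋-sym σ-fixed)) (act-invWord ψ _)

  FixedBy⇔Fixes : ∀ k σ → FixedBy k σ ⇔ Fixes (φ k) σ
  FixedBy⇔Fixes k σ = mk⇔ (λ fixed → subst (λ ψ → Fixes ψ σ) (++-identityʳ (φ k)) (fixed (+ 1))) powers
    where
    powers : Fixes (φ k) σ → FixedBy k σ
    powers σ-fixed (+ n)    = Fixes-^ᴺ (φ k) σ-fixed n
    powers σ-fixed -[1+ n ] = Fixes-^ᴺ (invWord (φ k)) (Fixes-invWord (φ k) σ-fixed) (suc n)

  Fixes-conjugate : ∀ l ψ ψ′ σ → act σ (l ∷ ψ) ≋ actLetter l (act σ ψ′) →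
                    Fixes ψ (actLetter l σ) ⇔ Fixes ψ′ σ
  Fixes-conjugate l ψ ψ′ σ commute = mk⇔ to from
    where
    open ≋-Reasoning
    to : Fixes ψ (actLetter l σ) → Fixes ψ′ σ
    to fixed = begin
      act σ ψ′                                             ≈⟨ actLetter-inverse l _ ⟨
      actLetter (invLetter l) (actLetter l (act σ ψ′))     ≈⟨ actLetter-cong (invLetter l) commute ⟨
      actLetter (invLetter l) (act (actLetter l σ) ψ)      ≈⟨ actLetter-cong (invLetter l) fixed ⟩
      actLetter (invLetter l) (actLetter l σ)              ≈⟨ actLetter-inverse l σ ⟩
      σ                                                    ∎
    from : Fixes ψ′ σ → Fixes ψ (actLetter l σ)
    from fixed = ≋-trans commute (actLetter-cong l fixed)

  Fixes-φ-act : ∀ w k σ → product σ ≈ ε → Fixes (φ k) (act σ w) ⇔ Fixes (φ (swapPairings w k)) σ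
  Fixes-φ-act []      k σ σ≈ε = ⇔-id _
  Fixes-φ-act (l ∷ w) k σ σ≈ε =
    Fixes-conjugate l (φ j) (φ (swapPairing (letterGen l) j)) σ (β-φ l j σ σ≈ε)
      ⇔-∘ Fixes-φ-act w k (actLetter l σ) (≈-trans (product-actLetter l σ) σ≈ε)
    where j = swapPairings w k

open Defs using (act; FixedBy)

theorem1 : ∀ {c ℓ} (G : Group c ℓ) → Finite G → (C : ClassVector G) →
    (k : Fin 3) → (σ : Quad (Group.Carrier G)) → InΣ G C σ →
    (w : Word) → Pure w →
    (FixedBy G k (act G σ w) ⇔ FixedBy G k σ)
theorem1 {c} {ℓ} G _ _ k σ ((_ , product≈ε) , _) w pure = begin
  FixedBy G k (act G σ w)         ≈⟨ FixedBy⇔Fixes k (act G σ w) ⟩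
  Fixes (φ k) (act G σ w)         ≈⟨ Fixes-φ-act w k σ product≈ε ⟩
  Fixes (φ (swapPairings w k)) σ  ≡⟨ cong (λ j → Fixes (φ j) σ) (Pure⇒swapPairings≡id w pure k) ⟩
  Fixes (φ k) σ                   ≈⟨ FixedBy⇔Fixes k σ ⟨
  FixedBy G k σ                   ∎
  where
  open HurwitzAction G
  open Relation.Binary.Reasoning.Setoid (⇔.⇔-setoid (c ⊔ ℓ))
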